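{- Let $G=(V,E)$ be a graph, $k$ a positive integer, and $B$ a $2$-branch of $G$ with umbrella ordering $\sigma_B$ whose $K$-join decomposition consists of $p\ge k+4$ sets. Assume that the attachment cliques $B_1$ and $B_2$ of $B$ belong to the same connected component of $G[V\setminus B^R]$. Then $G$ admits no $k$-completion.
   Context: A proper interval graph is a graph with an interval representation in which no interval strictly contains another. An umbrella ordering of a graph is an ordering $v_1,\dots,v_n$ of its vertices such that whenever $v_iv_j$ is an edge with $i<j$, then $v_iv_l,v_lv_j$ are edges for all $i<l<j$. A $k$-completion of $G$ is a set $F$ of at most $k$ non-edges of $G$ such that $G+F$ is a proper interval graph. A $2$-branch of $G$ is a set $B\subseteq V$ such that $G[B]$ is a connected proper interval graph with umbrella ordering $\sigma_B=b_1,\dots,b_{|B|}$, and $V\setminus B$ can be partitioned into $L,R,C$ with: no edges between $B$ and $C$; every vertex of $L$ and of $R$ has a neighbor in $B$; letting $b_l$ be the neighbor of $b_{|B|}$ with minimal index and $b_{l'}$ the neighbor of $b_1$ with maximal index in $\sigma_B$, there are no edges between $\{b_1,\dots,b_{l-1}\}$ and $R$ and no edges between $\{b_{l'+1},\dots,b_{|B|}\}$ and $L$; $N_R(b_i)\subseteq N_R(b_{i+1})$ for $l\le i<|B|$ and $N_L(b_{i+1})\subseteq N_L(b_i)$ for $1\le i<l'$. The attachment cliques are $B_1=\{b_1,\dots,b_{l'}\}$ and $B_2=\{b_l,\dots,b_{|B|}\}$, and $B^R=B\setminus(B_1\cup B_2)$. The $K$-join decomposition of $B$ (with respect to $\sigma_B$)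 is the sequence $B'_1,\dots,B'_p$ defined by $l_0=0$, $l_1=l'$, $B'_1=B_1$, and inductively, while $l_{i-1}<|B|$: if $b_{l_{i-1}+1}\in B_2$ then $B'_i=\{b_{l_{i-1}+1},\dots,b_{|B|}\}$ (and the process stops); otherwise $l_i$ is the maximal index of a neighbor of $b_{l_{i-1}+1}$ in $\sigma_B$ and $B'_i=\{b_{l_{i-1}+1},\dots,b_{l_i}\}$. -}

module Defs where

open import Data.Nat using (ℕ; zero; suc; _+_)
open import Data.Fin using (Fin; toℕ; _<_; _≤_) renaming (zero to fzero)
import Data.Fin as Fin
open import Data.Rational using (ℚ) renaming (_≤_ to _≤ℚ_; _<_ to _<ℚ_)
open import Data.Product using (Σ; ∃; _×_; _,_; proj₁; proj₂)
open import Data.Sum using (_⊎_)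
open import Data.List using (List; length)
import Data.Nat as ℕ
open import Data.List.Membership.Propositional using (_∈_)
open import Data.List.Relation.Unary.All using (All)
open import Relation.Nullary using (¬_)
open import Relation.Binary.PropositionalEquality using (_≡_; _≢_)
open import Relation.Binary.Construct.Closure.ReflexiveTransitive using (Star)

record Graph (n : ℕ) : Set₁ where
  field
    _~_      : Fin n → Fin n → Set
    ~-sym    : ∀ {u v} → u ~ v → v ~ u
    ~-irrefl : ∀ {u} → ¬ (u ~ u)

open Graph public

Interval : Set
Interval = ℚ × ℚ

Intersect : Interval → Interval → Set
Intersect (a , b) (c , d) = (a ≤ℚ d) × (c ≤ℚ b)

StrictlyContains : Interval → Interval → Set
StrictlyContains (a , b) (c , d) = (a ≤ℚ c) × (d ≤ℚ b) × ((a <ℚ c) ⊎ (d <ℚ b))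

ProperIntervalGraph : ∀ {N} → (Fin N → Fin N → Set) → Set
ProperIntervalGraph {N} R =
  Σ (Fin N → Interval) λ I →
    (∀ v → proj₁ (I v) ≤ℚ proj₂ (I v)) ×
    (∀ u v → u ≢ v → (R u v → Intersect (I u) (I v)) × (Intersect (I u) (I v) → R u v)) ×
    (∀ u v → ¬ StrictlyContains (I u) (I v))

-- The natural order 0,1,…,N-1 of Fin N is an umbrella ordering for R
Umbrella : ∀ {N} → (Fin N → Fin N → Set) → Set
Umbrella {N} R = ∀ (i l j : Fin N) → i < l → l < j → R i j → R i l × R l j

AddEdges : ∀ {n} → Graph n → List (Fin n × Fin n) → Fin n → Fin n → Set
AddEdges G F u v = _~_ G u v ⊎ ((u , v) ∈ F) ⊎ ((v , u) ∈ F)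

IsCompletion : ∀ {n} → Graph n → ℕ → List (Fin n × Fin n) → Set
IsCompletion G k F =
  (length F ℕ.≤ k) ×
  All (λ e → (proj₁ e ≢ proj₂ e) × ¬ (_~_ G (proj₁ e) (proj₂ e))) F ×
  ProperIntervalGraph (AddEdges G F)

-- 2-branches.  B is given by its umbrella ordering σ_B = b : Fin |B| → V
-- (0-based: b i is b_{i+1} of the paper); |B| = suc m.

data Side : Set where
  sideL sideR sideC : Side

module _ {n : ℕ} (G : Graph n) {m : ℕ} (b : Fin (suc m) → Fin n) where

  InB : Fin n → Set
  InB v = ∃ λ i → b i ≡ v

  -- v ∈ V \ B has been put into part s of the partition L,R,C
  InPart : (Fin n → Side) → Side → Fin n → Set
  InPart side s v = ¬ InB v × side v ≡ s

  CN : Fin (suc m) → Fin (suc m) → Set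
  CN i j = (i ≡ j) ⊎ _~_ G (b i) (b j)

  record TwoBranch : Set where
    field
      b-inj     : ∀ i j → b i ≡ b j → i ≡ j
      connected : ∀ i j → Star (λ x y → _~_ G (b x) (b y)) i j
      pig       : ProperIntervalGraph (λ x y → _~_ G (b x) (b y))
      umbrella  : Umbrella (λ x y → _~_ G (b x) (b y))
      side      : Fin n → Side
      noBC      : ∀ i v → InPart side sideC v → ¬ (_~_ G (b i) v)
      L-nb      : ∀ v → InPart side sideL v → ∃ λ i → _~_ G (b i) v
      R-nb      : ∀ v → InPart side sideR v → ∃ λ i → _~_ G (b i) v
      -- b_l : neighbour of b_{|B|} of minimal index
      l         : Fin (suc m)
      l-min     : CN l (Fin.fromℕ m) × (∀ i → i < l → ¬ CN i (Fin.fromℕ m))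
      -- b_l' : neighbour of b_1 of maximal index
      l'        : Fin (suc m)
      l'-max    : CN fzero l' × (∀ i → l' < i → ¬ CN fzero i)
      noR       : ∀ i v → i < l → InPart side sideR v → ¬ (_~_ G (b i) v)
      noL       : ∀ i v → l' < i → InPart side sideL v → ¬ (_~_ G (b i) v)
      R-mono    : ∀ i j → toℕ j ≡ suc (toℕ i) → l ≤ i →
                  ∀ v → InPart side sideR v → _~_ G (b i) v → _~_ G (b j) v
      L-mono    : ∀ i j → toℕ j ≡ suc (toℕ i) → j ≤ l' →
                  ∀ v → InPart side sideL v → _~_ G (b j) v → _~_ G (b i) v

  IsMaxCN : Fin (suc m) → Fin (suc m) → Set
  IsMaxCN x j = CN x j × (∀ y → CN x y → y ≤ j)

  module _ (T : TwoBranch) where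
    open TwoBranch T

    -- KSteps c q : starting from boundary l_{i-1} = c (number of vertices
    -- already covered), the K-join process produces exactly q further sets.
    data KSteps : ℕ → ℕ → Set where
      done  : KSteps (suc m) 0
      toEnd : ∀ {c} (x : Fin (suc m)) → toℕ x ≡ c → l ≤ x → KSteps c 1
      jump  : ∀ {c q} (x j : Fin (suc m)) → toℕ x ≡ c → x < l → IsMaxCN x j →
              KSteps (suc (toℕ j)) q → KSteps c (suc q)

    -- The K-join decomposition of B consists of exactly p sets
    -- (B'_1 = B_1, i.e. l_1 = l', then the process above).
    KJoinCount : ℕ → Set
    KJoinCount p = ∃ λ q → (p ≡ suc q) × KSteps (suc (toℕ l')) q

    -- vertices of B^R = B \ (B_1 ∪ B_2)
    InBR : Fin n → Set
    InBR v = ∃ λ i → (l' < i) × (i < l) × (b i ≡ v)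

    SameComponent : Set
    SameComponent = ∀ i j → i ≤ l' → l ≤ j →
      Star (λ u v → ¬ InBR u × ¬ InBR v × _~_ G u v) (b i) (b j)

module Submission where

-- Suppose G + F is a proper interval graph with |F| ≤ k. The walk from B₁ to B₂ avoiding B^R
-- passes through a stretch of vertices outside B whose intervals cover an interval; contract
-- them into one extra vertex. Starting next to B₁, jump repeatedly to the last neighbour in σ_B
-- until B₂ is reached. This greedy path makes at least as many jumps as the K-join
-- decomposition, hence at least k + 2; it is induced, and its inner vertices lie in B^R, so they
-- have no neighbours outside B. With the extra vertex it closes up to a cycle of length at least
-- k + 4 in the interval model of G + F, all of whose chords are edges of F. But a cycle of length
-- L in an interval model has at least L - 3 chords (the two neighbours of the interval with the
-- leftmost right end meet, so that vertex can be cut off at the price of one chord), whence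
-- |F| ≥ k + 1.

open import Defs
open import Data.Nat using (ℕ; suc; _+_; _≤_)
open import Data.Fin using (Fin)
open import Data.Product using (∃)
open import Relation.Nullary using (¬_)
open import Data.Nat as ℕ using (zero; z≤n; s≤s)
import Data.Nat.Properties as ℕ
open import Data.Fin as Fin using (toℕ; fromℕ; fromℕ<; inject₁; lower₁)
import Data.Fin.Properties as Fin
open import Data.Rational as ℚ using (ℚ)
import Data.Rational.Properties as ℚ
open import Data.Product using (_×_; _,_; proj₁; proj₂)
open import Data.Sum as Sum using (_⊎_; inj₁; inj₂)
open import Data.List using (List; _∷_; length)
open import Data.List.Properties using (length-removeAt′)
open import Data.List.Membership.Propositional using (_∈_)
open import Data.List.Relation.Unary.Any using (here; there; index; _─_)
open import Function using (_∘_)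
open import Relation.Nullary using (Dec; yes; no; contradiction; _×-dec_; _⊎-dec_)
import Relation.Nullary.Decidable as Dec
open import Relation.Unary using (Decidable)
open import Relation.Binary.Definitions using (tri<; tri≈; tri>)
open import Relation.Binary.PropositionalEquality using (_≡_; _≢_; refl; sym; trans; cong; subst)
open import Relation.Binary.Construct.Closure.ReflexiveTransitive using (Star; ε; _◅_)

minimiser : (f : ℕ → ℚ) (s : ℕ) → ∃ λ i → i ℕ.≤ s × (∀ j → j ℕ.≤ s → f i ℚ.≤ f j)
minimiser f zero = 0 , z≤n , λ { .zero z≤n → ℚ.≤-refl }
minimiser f (suc s) with minimiser f s
... | i , i≤s , min with f i ℚ.≤? f (suc s)
...   | yes fi≤ = i , ℕ.m≤n⇒m≤1+n i≤s , λ j j≤ → extend j j≤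
  where
  extend : ∀ j → j ℕ.≤ suc s → f i ℚ.≤ f j
  extend j j≤ with ℕ.m≤n⇒m<n∨m≡n j≤
  ... | inj₁ (s≤s j≤s) = min j j≤s
  ... | inj₂ refl      = fi≤
...   | no fi≰ = suc s , ℕ.≤-refl , λ j j≤ → extend j j≤
  where
  extend : ∀ j → j ℕ.≤ suc s → f (suc s) ℚ.≤ f j
  extend j j≤ with ℕ.m≤n⇒m<n∨m≡n j≤
  ... | inj₁ (s≤s j≤s) = ℚ.≤-trans (ℚ.<⇒≤ (ℚ.≰⇒> fi≰)) (min j j≤s)
  ... | inj₂ refl      = ℚ.≤-refl

least : ∀ {P : ℕ → Set} → Decidable P → ∀ {k} → P k → ∃ λ e → P e × (∀ i → i ℕ.< e → ¬ P i)
least {P} P? {k} pk = search k 0 (λ _ ()) (subst P (sym (ℕ.+-identityʳ k)) pk)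
  where
  search : ∀ d i → (∀ j → j ℕ.< i → ¬ P j) → P (d + i) → ∃ λ e → P e × (∀ j → j ℕ.< e → ¬ P j)
  search d i below pd+i with P? i
  ... | yes pi = i , pi , below
  search zero    i below pi    | no ¬pi = contradiction pi ¬pi
  search (suc d) i below pd+i | no ¬pi = search d (suc i) below′ (subst P (sym (ℕ.+-suc d i)) pd+i)
    where
    below′ : ∀ j → j ℕ.< suc i → ¬ P j
    below′ j (s≤s j≤i) with ℕ.m≤n⇒m<n∨m≡n j≤i
    ... | inj₁ j<i = below j j<i
    ... | inj₂ refl = ¬pi

greatest : ∀ {m} {P : Fin m → Set} → Decidable P → ∀ {x} → P x → ∃ λ j → P j × (∀ y → P y → y Fin.≤ j)
greatest {suc m} {P} P? {x} px with P? (fromℕ m)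
... | yes p = fromℕ m , p , λ y _ → Fin.≤fromℕ y
... | no ¬p =
  let (j , pj , max) = below
  in inject₁ j , pj , λ y py →
       ℕ.≤-trans (ℕ.≤-reflexive (sym (Fin.toℕ-lower₁ y (not-last py))))
                 (ℕ.≤-trans (max _ (lower py)) (ℕ.≤-reflexive (sym (Fin.toℕ-inject₁ j))))
  where
  not-last : ∀ {y} → P y → m ≢ toℕ y
  not-last py m≡y = ¬p (subst P (sym (Fin.toℕ-injective (trans (Fin.toℕ-fromℕ m) m≡y))) py)
  lower : ∀ {y} (py : P y) → P (inject₁ (lower₁ y (not-last py)))
  lower {y} py = subst P (sym (Fin.inject₁-lower₁ y (not-last py))) py
  below : ∃ λ j → P (inject₁ j) × (∀ y → P (inject₁ y) → y Fin.≤ j)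
  below = greatest (P? ∘ inject₁) (lower px)

∈-─⁺ : ∀ {A : Set} {x y : A} (xs : List A) (x∈xs : x ∈ xs) → y ∈ xs → y ≢ x → y ∈ (xs ─ x∈xs)
∈-─⁺ (_ ∷ _)  (here refl) (here refl) y≢x = contradiction refl y≢x
∈-─⁺ (_ ∷ _)  (here refl) (there y∈)  _   = y∈
∈-─⁺ (_ ∷ _)  (there _)   (here y≡)   _   = here y≡
∈-─⁺ (_ ∷ xs) (there x∈)  (there y∈)  y≢x = there (∈-─⁺ xs x∈ y∈ y≢x)

-- Intervals

lo hi : Interval → ℚ
lo = proj₁
hi = proj₂

Intersect-sym : ∀ {x y} → Intersect x y → Intersect y x
Intersect-sym (p , q) = q , p

-- Both x and z contain the right end of y.
Intersect-via-shorter : ∀ {x y z} → Intersect x y → Intersect y z →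
                        hi y ℚ.≤ hi x → hi y ℚ.≤ hi z → Intersect x z
Intersect-via-shorter (x≤y , _) (_ , z≤y) y≤x y≤z = ℚ.≤-trans x≤y y≤z , ℚ.≤-trans z≤y y≤x

Intersect? : ∀ x y → Dec (Intersect x y)
Intersect? (a , b) (c , d) = (a ℚ.≤? d) ×-dec (c ℚ.≤? b)

_⊆ᴵ_ : Interval → Interval → Set
x ⊆ᴵ y = lo y ℚ.≤ lo x × hi x ℚ.≤ hi y

Intersect-⊆ : ∀ {x y z} → Intersect x y → y ⊆ᴵ z → Intersect x z
Intersect-⊆ (x≤y , y≤x) (z≤y , y≤z) = ℚ.≤-trans x≤y y≤z , ℚ.≤-trans z≤y y≤x

Proper : Interval → Set
Proper x = lo x ℚ.≤ hi x

module Cover {X : Set} (I : X → Interval) (I-proper : ∀ x → Proper (I x)) where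

  Covered : (X → Set) → Interval → Set
  Covered P h = ∀ t → lo h ℚ.≤ t → t ℚ.≤ hi h → ∃ λ w → P w × lo (I w) ℚ.≤ t × t ℚ.≤ hi (I w)

  record Hull (P : X → Set) : Set where
    field
      span    : Interval
      proper  : Proper span
      covered : Covered P span

  open Hull public

  singleton : ∀ {P v} → P v → Hull P
  singleton {v = v} pv = record { span = I v ; proper = I-proper v ; covered = λ t v≤t t≤v → v , pv , v≤t , t≤v }

  extend : ∀ {P v} (H : Hull P) → P v → Intersect (I v) (span H) →
           ∃ λ (H′ : Hull P) → span H ⊆ᴵ span H′ × I v ⊆ᴵ span H′
  extend {P} {v} H pv (v≤h , h≤v) =
    record { span = span′ ; proper = proper′ ; covered = covered′ } ,
    (ℚ.p⊓q≤p _ _ , ℚ.p≤p⊔q _ _) , (ℚ.p⊓q≤q (lo (span H)) _ , ℚ.p≤q⊔p (hi (span H)) _)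
    where
    span′ : Interval
    span′ = lo (span H) ℚ.⊓ lo (I v) , hi (span H) ℚ.⊔ hi (I v)
    proper′ : Proper span′
    proper′ = ℚ.≤-trans (ℚ.p⊓q≤p _ _) (ℚ.≤-trans (proper H) (ℚ.p≤p⊔q _ _))
    covered′ : Covered P span′
    covered′ t lo≤t t≤hi with lo (I v) ℚ.≤? t | t ℚ.≤? hi (I v)
    ... | yes v≤t | yes t≤v = v , pv , v≤t , t≤v
    ... | no  v≰t | _ with ℚ.⊓-sel (lo (span H)) (lo (I v))
    ...   | inj₁ ⊓≡h = covered H t (subst (ℚ._≤ t) ⊓≡h lo≤t) (ℚ.≤-trans (ℚ.<⇒≤ (ℚ.≰⇒> v≰t)) v≤h)
    ...   | inj₂ ⊓≡v = contradiction (subst (ℚ._≤ t) ⊓≡v lo≤t) v≰t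
    covered′ t lo≤t t≤hi | yes _ | no t≰v with ℚ.⊔-sel (hi (span H)) (hi (I v))
    ...   | inj₁ ⊔≡h = covered H t (ℚ.≤-trans h≤v (ℚ.<⇒≤ (ℚ.≰⇒> t≰v))) (subst (t ℚ.≤_) ⊔≡h t≤hi)
    ...   | inj₂ ⊔≡v = contradiction (subst (t ℚ.≤_) ⊔≡v t≤hi) t≰v

  Hull-weaken : ∀ {P Q} → (∀ {w} → P w → Q w) → Hull P → Hull Q
  Hull-weaken P⇒Q H = record
    { span = span H ; proper = proper H
    ; covered = λ t h≤t t≤h → let (w , pw , w≤t , t≤w) = covered H t h≤t t≤h in w , P⇒Q pw , w≤t , t≤w }

  attach : ∀ {P u v} (H : Hull P) → Intersect (I v) (span H) → u ≡ v ⊎ (P v × Intersect (I u) (I v)) →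
           ∃ λ (H′ : Hull P) → span H ⊆ᴵ span H′ × Intersect (I u) (span H′)
  attach H v-meet (inj₁ refl) = H , (ℚ.≤-refl , ℚ.≤-refl) , v-meet
  attach H v-meet (inj₂ (pv , u-meet)) =
    let (H′ , H⊆H′ , v⊆H′) = extend H pv v-meet in H′ , H⊆H′ , Intersect-⊆ u-meet v⊆H′

  -- Look at the point max (lo h) (lo x) of the hull h.
  Hull-meet : ∀ {P x} (H : Hull P) → Intersect (span H) (I x) → ∃ λ w → P w × Intersect (I x) (I w)
  Hull-meet {x = x} H (h≤x , x≤h) with covered H (lo (span H) ℚ.⊔ lo (I x)) (ℚ.p≤p⊔q _ _) (ℚ.⊔-lub (proper H) x≤h)
  ... | w , pw , w≤t , t≤w = w , pw , ℚ.≤-trans (ℚ.p≤q⊔p (lo (span H)) _) t≤w , ℚ.≤-trans w≤t (ℚ.⊔-lub h≤x (I-proper x))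

  record Crossing (L R O : X → Set) : Set where
    field
      {left right} : X
      left∈L   : L left
      right∈R  : R right
      hull     : Hull O
      left-meet  : Intersect (I left) (span hull)
      right-meet : Intersect (I right) (span hull)

  module _ {W : X → X → Set} {L R O : X → Set}
           (W-meet : ∀ {u v} → W u v → Intersect (I u) (I v))
           (W-split : ∀ {u v} → W u v → L v ⊎ R v ⊎ O v)
           (L↛R : ∀ {u v} → L u → R v → ¬ W u v)
           (L∌R : ∀ {v} → L v → ¬ R v) (O∌R : ∀ {v} → O v → ¬ R v) where

    walk-crossing : ∀ {u y} → L u → R y → Star W u y → Crossing L R O
    crossing-from : ∀ {u₀ v y} → L u₀ → (H : Hull O) → Intersect (I u₀) (span H) →
                    O v → I v ⊆ᴵ span H → R y → Star W v y → Crossing L R O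

    walk-crossing lu ry ε = contradiction ry (L∌R lu)
    walk-crossing lu ry (uv ◅ rest) with W-split uv
    ... | inj₁ lv         = walk-crossing lv ry rest
    ... | inj₂ (inj₁ rv) = contradiction uv (L↛R lu rv)
    ... | inj₂ (inj₂ ov) = crossing-from lu (singleton ov) (W-meet uv) ov (ℚ.≤-refl , ℚ.≤-refl) ry rest

    crossing-from lu H u-meet ov v⊆H ry ε = contradiction ry (O∌R ov)
    crossing-from lu H u-meet ov v⊆H ry (vx ◅ rest) with W-split vx
    ... | inj₁ lx         = walk-crossing lx ry rest
    ... | inj₂ (inj₁ rx) = record { left∈L = lu ; right∈R = rx ; hull = H ; left-meet = u-meet
                                  ; right-meet = Intersect-⊆ (Intersect-sym (W-meet vx)) v⊆H }
    ... | inj₂ (inj₂ ox) with extend H ox (Intersect-⊆ (Intersect-sym (W-meet vx)) v⊆H)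
    ...   | H′ , H⊆H′ , x⊆H′ = crossing-from lu H′ (Intersect-⊆ u-meet H⊆H′) ox x⊆H′ ry rest

-- Cycles of intervals

-- punch i j is the old position of the j-th of 0,1,2,… once position i is removed.
punch : ℕ → ℕ → ℕ
punch zero    j       = suc j
punch (suc i) zero    = zero
punch (suc i) (suc j) = suc (punch i j)

punch-< : ∀ {i j} → j ℕ.< i → punch i j ≡ j
punch-< {suc i} {zero}  _         = refl
punch-< {suc i} {suc j} (s≤s j<i) = cong suc (punch-< j<i)

punch-≥ : ∀ {i j} → i ℕ.≤ j → punch i j ≡ suc j
punch-≥ {zero}          _         = refl
punch-≥ {suc i} {suc j} (s≤s i≤j) = cong suc (punch-≥ i≤j)

punch-suc : ∀ i j → suc j ≢ i → punch i (suc j) ≡ suc (punch i j)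
punch-suc zero             j       _    = refl
punch-suc (suc zero)       zero    1≢1  = contradiction refl 1≢1
punch-suc (suc (suc i))    zero    _    = refl
punch-suc (suc i)          (suc j) ne   = cong suc (punch-suc i j (ne ∘ cong suc))

j≤punch : ∀ i j → j ℕ.≤ punch i j
j≤punch zero    j       = ℕ.n≤1+n j
j≤punch (suc i) zero    = z≤n
j≤punch (suc i) (suc j) = s≤s (j≤punch i j)

punch≤suc : ∀ i j → punch i j ℕ.≤ suc j
punch≤suc zero    j       = ℕ.≤-refl
punch≤suc (suc i) zero    = z≤n
punch≤suc (suc i) (suc j) = s≤s (punch≤suc i j)

punch-mono-< : ∀ i {j j'} → j ℕ.< j' → punch i j ℕ.< punch i j'
punch-mono-< zero    j<j'                      = s≤s j<j'
punch-mono-< (suc i) {zero}  {suc j'} _         = s≤s z≤n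
punch-mono-< (suc i) {suc j} {suc j'} (s≤s j<j') = s≤s (punch-mono-< i j<j')

punch-injective : ∀ i {j j'} → punch i j ≡ punch i j' → j ≡ j'
punch-injective i {j} {j'} eq with ℕ.<-cmp j j'
... | tri< j<j' _ _ = contradiction eq (ℕ.<⇒≢ (punch-mono-< i j<j'))
... | tri≈ _ j≡j' _ = j≡j'
... | tri> _ _ j>j' = contradiction eq (ℕ.>⇒≢ (punch-mono-< i j>j'))

punch-gap : ∀ i {j j'} → suc j ℕ.< j' → suc (punch i j) ℕ.< punch i j'
punch-gap i {j} {j'} j+1<j' with j ℕ.<? i
... | yes j<i rewrite punch-< j<i = ℕ.<-≤-trans j+1<j' (j≤punch i j')
... | no  j≮i rewrite punch-≥ (ℕ.≮⇒≥ j≮i)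
                    | punch-≥ (ℕ.≤-trans (ℕ.≮⇒≥ j≮i) (ℕ.≤-trans (ℕ.n≤1+n j) (ℕ.<⇒≤ j+1<j'))) = s≤s j+1<j'

-- A cycle on the positions 0,…,s; its closing pair is (0, s).
Adjacent : ℕ → ℕ → ℕ → Set
Adjacent s i j = (j ≡ suc i × j ℕ.≤ s) ⊎ (i ≡ 0 × j ≡ s)

Neighbours : ℕ → ℕ → ℕ → Set
Neighbours s i j = Adjacent s i j ⊎ Adjacent s j i

Chord : ℕ → ℕ → ℕ → Set
Chord s i j = i ℕ.< j × j ℕ.≤ s × ¬ Adjacent s i j

punch-reflects-Adjacent : ∀ {t} i {j j'} → j ℕ.< j' → j' ℕ.≤ t →
                          Adjacent (suc t) (punch i j) (punch i j') → Adjacent t j j'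
punch-reflects-Adjacent i {j} {j'} j<j' j'≤t (inj₁ (p≡ , _)) =
  inj₁ (ℕ.≤-antisym (ℕ.≮⇒≥ (λ gap → ℕ.<-irrefl (sym p≡) (punch-gap i gap))) j<j' , j'≤t)
punch-reflects-Adjacent i {j} {j'} _ j'≤t (inj₂ (p≡0 , p≡t)) =
  inj₂ ( ℕ.n≤0⇒n≡0 (ℕ.≤-trans (j≤punch i j) (ℕ.≤-reflexive p≡0))
       , ℕ.≤-antisym j'≤t (ℕ.≤-pred (ℕ.≤-trans (ℕ.≤-reflexive (sym p≡t)) (punch≤suc i j'))))

punch-Chord : ∀ i {t j j'} → Chord t j j' → Chord (suc t) (punch i j) (punch i j')
punch-Chord i (j<j' , j'≤t , ¬adj) =
  punch-mono-< i j<j' , ℕ.≤-trans (punch≤suc i _) (s≤s j'≤t) ,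
  ¬adj ∘ punch-reflects-Adjacent i j<j' j'≤t

punch-link : ∀ i {t j} → suc j ℕ.≤ t → suc j ≢ i → Adjacent (suc t) (punch i j) (punch i (suc j))
punch-link i {j = j} j+1≤t j+1≢i = inj₁ (punch-suc i j j+1≢i , ℕ.≤-trans (punch≤suc i (suc j)) (s≤s j+1≤t))

-- Deleting position i from a cycle on 0,…,suc t leaves a cycle on 0,…,t in which
-- the two former neighbours of i, at new positions a and b, have become adjacent.
record Bridge (t i : ℕ) : Set where
  field
    a b          : ℕ
    a-neighbour  : Neighbours (suc t) i (punch i a)
    b-neighbour  : Neighbours (suc t) i (punch i b)
    bridge-chord : Chord (suc t) (punch i a) (punch i b)
    adjacent     : Adjacent t a b
    image        : ∀ {j j'} → Adjacent t j j' → Adjacent (suc t) (punch i j) (punch i j') ⊎ (j ≡ a × j' ≡ b)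

bridge : ∀ {t} i → 2 ℕ.≤ t → i ℕ.≤ suc t → Bridge t i
bridge {suc (suc t)} zero _ _ = record
  { a = 0 ; b = suc (suc t)
  ; a-neighbour  = inj₁ (inj₁ (refl , s≤s z≤n))
  ; b-neighbour  = inj₁ (inj₂ (refl , refl))
  ; bridge-chord = s≤s (s≤s z≤n) , ℕ.≤-refl , λ { (inj₁ (() , _)) ; (inj₂ (() , _)) }
  ; adjacent     = inj₂ (refl , refl)
  ; image        = λ { (inj₁ (refl , j'≤t)) → inj₁ (inj₁ (refl , s≤s j'≤t))
                     ; (inj₂ (refl , refl)) → inj₂ (refl , refl) }
  }
bridge {suc zero} zero (s≤s ()) _
bridge {t} (suc k) 2≤t (s≤s k≤t) with ℕ.m≤n⇒m<n∨m≡n k≤t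
... | inj₂ refl = record
  { a = 0 ; b = t
  ; a-neighbour  = inj₂ (inj₂ (refl , refl))
  ; b-neighbour  = inj₂ (inj₁ (cong suc (sym last) , ℕ.≤-refl))
  ; bridge-chord = ℕ.≤-trans (ℕ.≤-trans (s≤s z≤n) 2≤t) (ℕ.≤-reflexive (sym last))
                 , ℕ.≤-trans (ℕ.≤-reflexive last) (ℕ.n≤1+n t)
                 , far
  ; adjacent     = inj₂ (refl , refl)
  ; image        = image
  }
  where
  last : punch (suc t) t ≡ t
  last = punch-< (ℕ.n<1+n t)
  far : ¬ Adjacent (suc t) 0 (punch (suc t) t)
  far (inj₁ (eq , _)) = ℕ.<-irrefl (sym (trans (sym last) eq)) 2≤t
  far (inj₂ (_ , eq)) = ℕ.<-irrefl (trans (sym last) eq) (ℕ.n<1+n t)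
  image : ∀ {j j'} → Adjacent t j j' → Adjacent (suc t) (punch (suc t) j) (punch (suc t) j') ⊎ (j ≡ 0 × j' ≡ t)
  image (inj₁ (refl , j'≤t)) = inj₁ (punch-link (suc t) j'≤t (ℕ.<⇒≢ (s≤s j'≤t)))
  image (inj₂ (refl , refl)) = inj₂ (refl , refl)
... | inj₁ k<t = record
  { a = k ; b = suc k
  ; a-neighbour  = inj₂ (inj₁ (cong suc (sym before) , s≤s (ℕ.<⇒≤ k<t)))
  ; b-neighbour  = inj₁ (inj₁ (after , ℕ.≤-trans (ℕ.≤-reflexive after) (s≤s k<t)))
  ; bridge-chord = ℕ.≤-trans (ℕ.≤-reflexive (cong suc before)) (ℕ.≤-trans (ℕ.n≤1+n (suc k)) (ℕ.≤-reflexive (sym after)))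
                 , ℕ.≤-trans (ℕ.≤-reflexive after) (s≤s k<t)
                 , far
  ; adjacent     = inj₁ (refl , k<t)
  ; image        = image
  }
  where
  before : punch (suc k) k ≡ k
  before = punch-< (ℕ.n<1+n k)
  after : punch (suc k) (suc k) ≡ suc (suc k)
  after = punch-≥ ℕ.≤-refl
  far : ¬ Adjacent (suc t) (punch (suc k) k) (punch (suc k) (suc k))
  far rewrite before | after = λ
    { (inj₁ (eq , _))     → ℕ.<-irrefl (sym eq) (ℕ.n<1+n (suc k))
    ; (inj₂ (k≡0 , eq)) → ℕ.<-irrefl (trans (cong (suc ∘ suc) (sym k≡0)) eq) (s≤s 2≤t) }
  image : ∀ {j j'} → Adjacent t j j' → Adjacent (suc t) (punch (suc k) j) (punch (suc k) j') ⊎ (j ≡ k × j' ≡ suc k)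
  image {j} (inj₁ (refl , j'≤t)) with suc j ℕ.≟ suc k
  ... | yes refl     = inj₂ (refl , refl)
  ... | no  j+1≢k+1 = inj₁ (punch-link (suc k) j'≤t j+1≢k+1)
  image (inj₂ (refl , refl)) = inj₁ (inj₂ (refl , punch-≥ k<t))

record TaggedCycle {A : Set} (s : ℕ) (J : ℕ → Interval) (Tag : ℕ → ℕ → A → Set) (F : List A) : Set where
  field
    adjacent-meet : ∀ {i j} → Adjacent s i j → Intersect (J i) (J j)
    chord-tagged  : ∀ {i j} → Chord s i j → Intersect (J i) (J j) → ∃ λ e → e ∈ F × Tag i j e
    tag-injective : ∀ {i j i' j' e} → Chord s i j → Chord s i' j' → Tag i j e → Tag i' j' e → i ≡ i' × j ≡ j'

module _ {A : Set} {t : ℕ} {J : ℕ → Interval} {Tag : ℕ → ℕ → A → Set} {F : List A} where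

  delete-vertex : TaggedCycle (suc t) J Tag F → ∀ i (B : Bridge t i) → let open Bridge B in
                  ∀ {e₀} (e₀∈F : e₀ ∈ F) → Tag (punch i a) (punch i b) e₀ →
                  Intersect (J (punch i a)) (J (punch i b)) →
                  TaggedCycle t (J ∘ punch i) (λ j j' → Tag (punch i j) (punch i j')) (F ─ e₀∈F)
  delete-vertex C i B {e₀} e₀∈F tag₀ meet = record
    { adjacent-meet = adjacent-meet′
    ; chord-tagged  = chord-tagged′
    ; tag-injective = λ ch ch' tg tg' → let (eq₁ , eq₂) = tag-injective (punch-Chord i ch) (punch-Chord i ch') tg tg'
                                        in punch-injective i eq₁ , punch-injective i eq₂
    }
    where
    open TaggedCycle C
    open Bridge B
    adjacent-meet′ : ∀ {j j'} → Adjacent t j j' → Intersect (J (punch i j)) (J (punch i j'))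
    adjacent-meet′ adj with image adj
    ... | inj₁ adj′         = adjacent-meet adj′
    ... | inj₂ (refl , refl) = meet
    chord-tagged′ : ∀ {j j'} → Chord t j j' → Intersect (J (punch i j)) (J (punch i j')) →
                    ∃ λ e → e ∈ (F ─ e₀∈F) × Tag (punch i j) (punch i j') e
    chord-tagged′ ch@(_ , _ , ¬adj) m with chord-tagged (punch-Chord i ch) m
    ... | e , e∈F , tag = e , ∈-─⁺ F e₀∈F e∈F e≢e₀ , tag
      where
      e≢e₀ : e ≢ e₀
      e≢e₀ refl with tag-injective (punch-Chord i ch) bridge-chord tag tag₀
      ... | eq₁ , eq₂ with punch-injective i eq₁ | punch-injective i eq₂
      ... | refl | refl = ¬adj adjacent

  cut-off : TaggedCycle (suc t) J Tag F → 2 ℕ.≤ t →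
            (∀ {J′ Tag′} {F′ : List A} → TaggedCycle t J′ Tag′ F′ → t ℕ.≤ 2 + length F′) →
            suc t ℕ.≤ 2 + length F
  cut-off C 2≤t induction with minimiser (hi ∘ J) (suc t)
  ... | i , i≤s , shortest =
    let (_ , e₀∈F , tag₀) = chord-tagged bridge-chord meet
    in subst (suc t ℕ.≤_) (cong (2 +_) (sym (length-removeAt′ F (index e₀∈F))))
             (s≤s (induction (delete-vertex C i B e₀∈F tag₀ meet)))
    where
    open TaggedCycle C
    B : Bridge t i
    B = bridge i 2≤t i≤s
    open Bridge B
    neighbour-meet : ∀ {x} → Neighbours (suc t) i x → Intersect (J i) (J x)
    neighbour-meet (inj₁ adj) = adjacent-meet adj
    neighbour-meet (inj₂ adj) = Intersect-sym (adjacent-meet adj)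
    b≤s : punch i b ℕ.≤ suc t
    b≤s = proj₁ (proj₂ bridge-chord)
    meet : Intersect (J (punch i a)) (J (punch i b))
    meet = Intersect-via-shorter (Intersect-sym (neighbour-meet a-neighbour)) (neighbour-meet b-neighbour)
             (shortest _ (ℕ.<⇒≤ (ℕ.<-≤-trans (proj₁ bridge-chord) b≤s))) (shortest _ b≤s)

TaggedCycle⇒s≤2+|F| : ∀ {A : Set} s {J Tag} {F : List A} → TaggedCycle s J Tag F → s ℕ.≤ 2 + length F
TaggedCycle⇒s≤2+|F| zero                  _ = z≤n
TaggedCycle⇒s≤2+|F| (suc zero)            _ = s≤s z≤n
TaggedCycle⇒s≤2+|F| (suc (suc zero))      _ = s≤s (s≤s z≤n)
TaggedCycle⇒s≤2+|F| (suc t@(suc (suc _))) C = cut-off C (s≤s (s≤s z≤n)) (TaggedCycle⇒s≤2+|F| t)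

-- Tags of chords by unordered pairs of vertices, where At i x says that x may stand at position i.
PairTag : {X : Set} → (ℕ → X → Set) → ℕ → ℕ → X × X → Set
PairTag At i j e = ∃ λ x → ∃ λ y → At i x × At j y × (e ≡ (x , y) ⊎ e ≡ (y , x))

PairTag-injective : ∀ {X : Set} {At : ℕ → X → Set} {s} →
                    (∀ {i j x} → i ℕ.≤ s → j ℕ.≤ s → At i x → At j x → i ≡ j) →
                    ∀ {i j i' j' e} → Chord s i j → Chord s i' j' →
                    PairTag At i j e → PairTag At i' j' e → i ≡ i' × j ≡ j'
PairTag-injective {s = s} At-unique {i} {j} {i'} {j'} (i<j , j≤s , _) (i'<j' , j'≤s , _)
                  (x , y , at-x , at-y , e≡) (x' , y' , at-x' , at-y' , e≡') = compare e≡ e≡'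
  where
  i≤s : i ℕ.≤ s
  i≤s = ℕ.<⇒≤ (ℕ.<-≤-trans i<j j≤s)
  i'≤s : i' ℕ.≤ s
  i'≤s = ℕ.<⇒≤ (ℕ.<-≤-trans i'<j' j'≤s)
  crossed : i ≡ j' → j ≡ i' → i ≡ i' × j ≡ j'
  crossed refl refl = contradiction (ℕ.<-trans i<j i'<j') (ℕ.<-irrefl refl)
  compare : ∀ {e} → e ≡ (x , y) ⊎ e ≡ (y , x) → e ≡ (x' , y') ⊎ e ≡ (y' , x') → i ≡ i' × j ≡ j'
  compare (inj₁ refl) (inj₁ refl) = At-unique i≤s i'≤s at-x at-x' , At-unique j≤s j'≤s at-y at-y'
  compare (inj₂ refl) (inj₂ refl) = At-unique i≤s i'≤s at-x at-x' , At-unique j≤s j'≤s at-y at-y'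
  compare (inj₁ refl) (inj₂ refl) = crossed (At-unique i≤s j'≤s at-x at-y') (At-unique j≤s i'≤s at-y at-x')
  compare (inj₂ refl) (inj₁ refl) = crossed (At-unique i≤s j'≤s at-x at-y') (At-unique j≤s i'≤s at-y at-x')

-- 2-branches

module TwoBranchFacts {n} (G : Graph n) {m} (b : Fin (suc m) → Fin n) (T : TwoBranch G b) where
  open TwoBranch T

  Pos : Set
  Pos = Fin (suc m)

  infix 4 _∼_
  _∼_ : Pos → Pos → Set
  x ∼ y = _~_ G (b x) (b y)

  ∼-shrinkʳ : ∀ {x y z} → x Fin.< y → y Fin.≤ z → x ∼ z → x ∼ y
  ∼-shrinkʳ {x} {y} {z} x<y y≤z x∼z with y Fin.≟ z
  ... | yes refl = x∼z
  ... | no  y≢z  = proj₁ (umbrella x y z x<y (Fin.≤∧≢⇒< y≤z y≢z) x∼z)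

  ∼-shrinkˡ : ∀ {x y z} → x Fin.≤ y → y Fin.< z → x ∼ z → y ∼ z
  ∼-shrinkˡ {x} {y} {z} x≤y y<z x∼z with x Fin.≟ y
  ... | yes refl = x∼z
  ... | no  x≢y  = proj₂ (umbrella x y z (Fin.≤∧≢⇒< x≤y x≢y) y<z x∼z)

  crossing-edge : ∀ {u v} → Star _∼_ u v → ∀ t → toℕ u ℕ.≤ t → t ℕ.< toℕ v →
                  ∃ λ x → ∃ λ y → toℕ x ℕ.≤ t × t ℕ.< toℕ y × x ∼ y
  crossing-edge ε t u≤t t<u = contradiction (ℕ.≤-<-trans u≤t t<u) (ℕ.<-irrefl refl)
  crossing-edge {u} (_◅_ {j = w} u∼w w⇝v) t u≤t t<v with toℕ w ℕ.≤? t
  ... | yes w≤t = crossing-edge w⇝v t w≤t t<v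
  ... | no  w≰t = u , w , u≤t , ℕ.≰⇒> w≰t , u∼w

  -- Connectivity gives an edge across every gap, and the umbrella property moves it onto the gap.
  ∼-suc : ∀ {x y} → toℕ y ≡ suc (toℕ x) → x ∼ y
  ∼-suc {x} {y} y≡x+1 with crossing-edge (connected x y) (toℕ x) ℕ.≤-refl (ℕ.≤-reflexive (sym y≡x+1))
  ... | u , w , u≤x , x<w , u∼w =
    ∼-shrinkʳ (ℕ.≤-reflexive (sym y≡x+1)) (subst (ℕ._≤ toℕ w) (sym y≡x+1) x<w) (∼-shrinkˡ u≤x x<w u∼w)

  -- Adjacency is not assumed decidable; inside B it is decided by the interval model of G[B].
  ∼-dec : ∀ x y → Dec (x ∼ y)
  ∼-dec x y with x Fin.≟ y
  ... | yes refl = no (~-irrefl G)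
  ... | no  x≢y  = Dec.map′ (proj₂ model) (proj₁ model) (Intersect? (proj₁ pig x) (proj₁ pig y))
    where
    model : (x ∼ y → Intersect (proj₁ pig x) (proj₁ pig y)) × (Intersect (proj₁ pig x) (proj₁ pig y) → x ∼ y)
    model = proj₁ (proj₂ (proj₂ pig)) x y x≢y

  CN-dec : ∀ x y → Dec (CN G b x y)
  CN-dec x y = (x Fin.≟ y) ⊎-dec (∼-dec x y)

  CN⇒∼ : ∀ {x y} → CN G b x y → x ≢ y → x ∼ y
  CN⇒∼ (inj₁ x≡y) x≢y = contradiction x≡y x≢y
  CN⇒∼ (inj₂ x∼y) _   = x∼y

  -- The last closed neighbour of x: the step of the K-join decomposition.
  opaque
    reach : Pos → Pos
    reach x = proj₁ (greatest (CN-dec x) (inj₁ refl))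

    reach-IsMaxCN : ∀ x → IsMaxCN G b x (reach x)
    reach-IsMaxCN x = proj₂ (greatest (CN-dec x) (inj₁ refl))

  module _ {x j} (max : IsMaxCN G b x j) where

    IsMaxCN-≥ : x Fin.≤ j
    IsMaxCN-≥ = proj₂ max x (inj₁ refl)

    IsMaxCN-∼ : x Fin.< j → x ∼ j
    IsMaxCN-∼ x<j = CN⇒∼ (proj₁ max) (λ x≡j → ℕ.<-irrefl (cong toℕ x≡j) x<j)

    IsMaxCN-≁ : ∀ {y} → j Fin.< y → ¬ x ∼ y
    IsMaxCN-≁ j<y x∼y = ℕ.<-irrefl refl (ℕ.<-≤-trans j<y (proj₂ max _ (inj₂ x∼y)))

  IsMaxCN-mono : ∀ {x y j j'} → IsMaxCN G b x j → IsMaxCN G b y j' → x Fin.≤ y → j Fin.≤ j'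
  IsMaxCN-mono {x} {y} {j} max max′ x≤y with j Fin.≤? y
  ... | yes j≤y = ℕ.≤-trans j≤y (IsMaxCN-≥ max′)
  ... | no  j≰y = proj₂ max′ j (inj₂ (∼-shrinkˡ x≤y y<j (IsMaxCN-∼ max (ℕ.≤-<-trans x≤y y<j))))
    where
    y<j : y Fin.< j
    y<j = ℕ.≰⇒> j≰y

  reach-> : ∀ x → toℕ x ℕ.< m → x Fin.< reach x
  reach-> x x<m = subst (ℕ._≤ toℕ (reach x)) (Fin.toℕ-fromℕ< (s≤s x<m))
                    (proj₂ (reach-IsMaxCN x) _ (inj₂ (∼-suc (Fin.toℕ-fromℕ< (s≤s x<m)))))

  reach^ : ℕ → Pos → Pos
  reach^ zero    x = x
  reach^ (suc i) x = reach (reach^ i x)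

  reach^-suc : ∀ i x → reach^ (suc i) x ≡ reach^ i (reach x)
  reach^-suc zero    x = refl
  reach^-suc (suc i) x = cong reach (reach^-suc i x)

  jumps : ∀ {c q} → KSteps G b T c q → ℕ
  jumps done                  = 0
  jumps (toEnd _ _ _)         = 0
  jumps (jump _ _ _ _ _ rest) = suc (jumps rest)

  count≤1+jumps : ∀ {c q} (ks : KSteps G b T c q) → q ℕ.≤ suc (jumps ks)
  count≤1+jumps done                  = z≤n
  count≤1+jumps (toEnd _ _ _)         = s≤s z≤n
  count≤1+jumps (jump _ _ _ _ _ rest) = s≤s (count≤1+jumps rest)

  -- The greedy iterates never overtake the boundaries of the K-join decomposition.
  reach^-<l : ∀ {c q} (ks : KSteps G b T c q) x → toℕ x ℕ.< c → ∀ i → i ℕ.< jumps ks → reach^ i x Fin.< l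
  reach^-<l (jump y j refl y<l _ _) x x<y zero _ = ℕ.<-trans x<y y<l
  reach^-<l (jump y j refl _ max rest) x x<y (suc i) (s≤s i<) rewrite reach^-suc i x =
    reach^-<l rest (reach x) (s≤s (IsMaxCN-mono (reach-IsMaxCN x) max (ℕ.<⇒≤ x<y))) i i<

  first-jump : ∀ {c q} (ks : KSteps G b T c q) → 1 ℕ.≤ jumps ks → ∃ λ (y : Pos) → toℕ y ≡ c × y Fin.< l
  first-jump (jump y _ y≡c y<l _ _) _ = y , y≡c , y<l

  two-jumps : ∀ {c q} (ks : KSteps G b T c q) → 2 ℕ.≤ jumps ks →
              ∃ λ (y₁ : Pos) → ∃ λ (y₂ : Pos) → toℕ y₁ ≡ c × y₁ Fin.< y₂ × y₂ Fin.< l × ¬ y₁ ∼ y₂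
  two-jumps (jump y₁ j₁ y₁≡c _ max₁ rest) (s≤s 1≤) with first-jump rest 1≤
  ... | y₂ , y₂≡ , y₂<l = y₁ , y₂ , y₁≡c , ℕ.≤-<-trans (IsMaxCN-≥ max₁) j₁<y₂ , y₂<l , IsMaxCN-≁ max₁ j₁<y₂
    where
    j₁<y₂ : j₁ Fin.< y₂
    j₁<y₂ = ℕ.≤-reflexive (sym y₂≡)

  -- Two non-adjacent vertices strictly between B₁ and B₂ separate them.
  B₁≁B₂ : ∀ {q} (ks : KSteps G b T (suc (toℕ l')) q) → 2 ℕ.≤ jumps ks →
          l' Fin.< l × (∀ {x y} → x Fin.≤ l' → l Fin.≤ y → ¬ x ∼ y)
  B₁≁B₂ ks 2≤ with two-jumps ks 2≤
  ... | y₁ , y₂ , y₁≡ , y₁<y₂ , y₂<l , y₁≁y₂ =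
    ℕ.<-trans l'<y₁ (ℕ.<-trans y₁<y₂ y₂<l) , λ x≤l' l≤y x∼y →
      y₁≁y₂ (∼-shrinkˡ (ℕ.<⇒≤ (ℕ.≤-<-trans x≤l' l'<y₁)) y₁<y₂
               (∼-shrinkʳ (ℕ.<-trans (ℕ.≤-<-trans x≤l' l'<y₁) y₁<y₂) (ℕ.<⇒≤ (ℕ.<-≤-trans y₂<l l≤y)) x∼y))
    where
    l'<y₁ : l' Fin.< y₁
    l'<y₁ = ℕ.≤-reflexive (sym y₁≡)

  reach-≥ : ∀ x → x Fin.≤ reach x
  reach-≥ x = IsMaxCN-≥ (reach-IsMaxCN x)

  reach^-climbs : ∀ k x → k ℕ.≤ m → k ℕ.≤ toℕ (reach^ k x)
  reach^-climbs zero    x _ = z≤n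
  reach^-climbs (suc k) x k<m with toℕ (reach^ k x) ℕ.<? m
  ... | yes y<m = ℕ.<-≤-trans (s≤s (reach^-climbs k x (ℕ.<⇒≤ k<m))) (reach-> _ y<m)
  ... | no  y≮m = ℕ.≤-trans k<m (ℕ.≤-trans (ℕ.≮⇒≥ y≮m) (reach-≥ _))

  B₁-clique : ∀ {x} → x Fin.< l' → x ∼ l'
  B₁-clique x<l' = ∼-shrinkˡ z≤n x<l' (CN⇒∼ (proj₁ l'-max) λ 0≡l' → ℕ.<-irrefl (cong toℕ 0≡l') (ℕ.≤-<-trans z≤n x<l'))

  B₂-clique : ∀ {y z} → l Fin.≤ y → y Fin.< z → y ∼ z
  B₂-clique {y} {z} l≤y y<z = ∼-shrinkʳ y<z z≤m (∼-shrinkˡ l≤y y<m (CN⇒∼ (proj₁ l-min) l≢m))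
    where
    z≤m : z Fin.≤ fromℕ m
    z≤m = Fin.≤fromℕ z
    y<m : y Fin.< fromℕ m
    y<m = ℕ.<-≤-trans y<z z≤m
    l≢m : l ≢ fromℕ m
    l≢m l≡m = ℕ.<-irrefl (cong toℕ l≡m) (ℕ.≤-<-trans l≤y y<m)

  inner-isolated : ∀ {x w} → l' Fin.< x → x Fin.< l → ¬ InB G b w → ¬ _~_ G (b x) w
  inner-isolated {x} {w} l'<x x<l w∉B with side w in eq
  ... | sideL = noL x w l'<x (w∉B , eq)
  ... | sideR = noR x w x<l (w∉B , eq)
  ... | sideC = noBC x w (w∉B , eq)

-- Completions

module Completion {n} (G : Graph n) {m} (b : Fin (suc m) → Fin n) (T : TwoBranch G b)
                  (SC : SameComponent G b T)
                  {q} (ks : KSteps G b T (suc (toℕ (TwoBranch.l' T))) q)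
                  (2≤jumps : 2 ℕ.≤ TwoBranchFacts.jumps G b T ks)
                  (F : List (Fin n × Fin n)) (I : Fin n → Interval) (I-proper : ∀ v → Proper (I v))
                  (I-model : ∀ u v → u ≢ v → (AddEdges G F u v → Intersect (I u) (I v)) ×
                                              (Intersect (I u) (I v) → AddEdges G F u v))
                  where
  open TwoBranch T
  open TwoBranchFacts G b T
  open Cover I I-proper

  l'<l : l' Fin.< l
  l'<l = proj₁ (B₁≁B₂ ks 2≤jumps)

  l≤m : toℕ l ℕ.≤ m
  l≤m = Fin.toℕ≤pred[n] l

  ~⇒meet : ∀ {u v} → _~_ G u v → Intersect (I u) (I v)
  ~⇒meet {u} {v} u~v = proj₁ (I-model u v λ { refl → ~-irrefl G u~v }) (inj₁ u~v)

  meet⇒F : ∀ {u v} → u ≢ v → ¬ _~_ G u v → Intersect (I u) (I v) → (u , v) ∈ F ⊎ (v , u) ∈ F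
  meet⇒F {u} {v} u≢v u≁v meet with proj₂ (I-model u v u≢v) meet
  ... | inj₁ u~v = contradiction u~v u≁v
  ... | inj₂ uv∈F = uv∈F

  Outside : Fin n → Set
  Outside v = ¬ InB G b v

  InB₁ InB₂ : Fin n → Set
  InB₁ v = ∃ λ a → a Fin.≤ l' × b a ≡ v
  InB₂ v = ∃ λ c → l Fin.≤ c × b c ≡ v

  classify : ∀ v → ¬ InBR G b T v → InB₁ v ⊎ InB₂ v ⊎ Outside v
  classify v v∉Bᴿ with Fin.any? (λ i → b i Fin.≟ v)
  ... | no  v∉B = inj₂ (inj₂ v∉B)
  ... | yes (i , bi≡v) with i Fin.≤? l' | l Fin.≤? i
  ...   | yes i≤l' | _       = inj₁ (i , i≤l' , bi≡v)
  ...   | no  _    | yes l≤i = inj₂ (inj₁ (i , l≤i , bi≡v))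
  ...   | no  i≰l' | no  l≰i = contradiction (i , ℕ.≰⇒> i≰l' , ℕ.≰⇒> l≰i , bi≡v) v∉Bᴿ

  InB₁≁InB₂ : ∀ {u v} → InB₁ u → InB₂ v → ¬ _~_ G u v
  InB₁≁InB₂ (_ , a≤l' , refl) (_ , l≤c , refl) = proj₂ (B₁≁B₂ ks 2≤jumps) a≤l' l≤c

  InB₁∌InB₂ : ∀ {v} → InB₁ v → ¬ InB₂ v
  InB₁∌InB₂ (a , a≤l' , refl) (c , l≤c , bc≡ba) =
    ℕ.<-irrefl refl (ℕ.<-≤-trans l'<l (ℕ.≤-trans l≤c (subst (Fin._≤ l') (sym (b-inj c a bc≡ba)) a≤l')))

  Outside∌InB₂ : ∀ {v} → Outside v → ¬ InB₂ v
  Outside∌InB₂ v∉B (c , _ , refl) = v∉B (c , refl)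

  crossing : Crossing InB₁ InB₂ Outside
  crossing = walk-crossing (~⇒meet ∘ proj₂ ∘ proj₂) (λ (_ , v∉Bᴿ , _) → classify _ v∉Bᴿ)
    (λ u∈B₁ v∈B₂ → InB₁≁InB₂ u∈B₁ v∈B₂ ∘ proj₂ ∘ proj₂) InB₁∌InB₂ Outside∌InB₂
    (l' , ℕ.≤-refl , refl) (l , ℕ.≤-refl , refl) (SC l' l ℕ.≤-refl ℕ.≤-refl)

  open Crossing crossing

  a c : Pos
  a = proj₁ left∈L
  c = proj₁ right∈R

  a≤l' : a Fin.≤ l'
  a≤l' = proj₁ (proj₂ left∈L)

  l≤c : l Fin.≤ c
  l≤c = proj₁ (proj₂ right∈R)

  a-meet : Intersect (I (b a)) (span hull)
  a-meet = subst (λ v → Intersect (I v) (span hull)) (sym (proj₂ (proj₂ left∈L))) left-meet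

  c-meet : Intersect (I (b c)) (span hull)
  c-meet = subst (λ v → Intersect (I v) (span hull)) (sym (proj₂ (proj₂ right∈R))) right-meet

  l'<m : toℕ l' ℕ.< m
  l'<m = ℕ.<-≤-trans l'<l l≤m

  -- The greedy path starts at a, unless a does not reach past B₁: then it starts at l', and a is
  -- contracted instead, so that no inner vertex of the path is adjacent to a.
  data Start : Pos → Set where
    from-a  : l' Fin.< reach a → Start a
    from-l' : reach a Fin.≤ l' → a Fin.< l' → Start l'

  opaque
    start-exists : ∃ Start
    start-exists with l' Fin.<? reach a
    ... | yes l'<ra = a , from-a l'<ra
    ... | no  l'≮ra = l' , from-l' ra≤l' (ℕ.≤∧≢⇒< a≤l' a≢l')
      where
      ra≤l' : reach a Fin.≤ l'
      ra≤l' = ℕ.≮⇒≥ l'≮ra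
      a≢l' : toℕ a ≢ toℕ l'
      a≢l' a≡l' = ℕ.<-irrefl refl (ℕ.<-≤-trans (reach-> l' l'<m)
                    (subst (λ x → reach x Fin.≤ l') (Fin.toℕ-injective a≡l') ra≤l'))

  start : Pos
  start = proj₁ start-exists

  start-case : Start start
  start-case = proj₂ start-exists

  Start-≤l' : ∀ {x} → Start x → x Fin.≤ l'
  Start-≤l' (from-a _)    = a≤l'
  Start-≤l' (from-l' _ _) = ℕ.≤-refl

  Start-reach : ∀ {x} → Start x → l' Fin.< reach x
  Start-reach (from-a l'<ra) = l'<ra
  Start-reach (from-l' _ _)  = reach-> l' l'<m

  path : ℕ → Pos
  path i = reach^ i start

  opaque
    first-in-B₂ : ∃ λ e → l Fin.≤ path e × (∀ i → i ℕ.< e → ¬ l Fin.≤ path i)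
    first-in-B₂ = least {P = λ i → l Fin.≤ path i} (λ i → l Fin.≤? path i) {toℕ l} (reach^-climbs (toℕ l) start l≤m)

  e : ℕ
  e = proj₁ first-in-B₂

  l≤path-e : l Fin.≤ path e
  l≤path-e = proj₁ (proj₂ first-in-B₂)

  path-<l : ∀ {i} → i ℕ.< e → path i Fin.< l
  path-<l {i} i<e = ℕ.≰⇒> (proj₂ (proj₂ first-in-B₂) i i<e)

  path-step : ∀ {i} → i ℕ.< e → path i Fin.< path (suc i)
  path-step i<e = reach-> _ (ℕ.<-≤-trans (path-<l i<e) l≤m)

  path-∼ : ∀ {i} → i ℕ.< e → path i ∼ path (suc i)
  path-∼ i<e = IsMaxCN-∼ (reach-IsMaxCN _) (path-step i<e)

  path-mono : ∀ {i j} → i ℕ.< j → j ℕ.≤ e → path i Fin.< path j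
  path-mono {i} {suc j} (s≤s i≤j) j<e with ℕ.m≤n⇒m<n∨m≡n i≤j
  ... | inj₁ i<j  = ℕ.<-trans (path-mono i<j (ℕ.<⇒≤ j<e)) (path-step j<e)
  ... | inj₂ refl = path-step j<e

  l'<path : ∀ {i} → 0 ℕ.< i → i ℕ.≤ e → l' Fin.< path i
  l'<path {suc zero}    _ _   = Start-reach start-case
  l'<path {suc (suc i)} _ i≤e = ℕ.<-trans (Start-reach start-case) (path-mono (s≤s (s≤s z≤n)) i≤e)

  jumps≤e : jumps ks ℕ.≤ e
  jumps≤e = ℕ.≮⇒≥ λ e<jumps → ℕ.<-irrefl refl
    (ℕ.<-≤-trans (reach^-<l ks start (s≤s (Start-≤l' start-case)) e e<jumps) l≤path-e)

  -- The greedy path ends at c unless it jumps past c; then c is contracted instead.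
  data Finish : Pos → Set where
    at-c    : c Fin.≤ path e → Finish c
    at-path : path e Fin.< c → Finish (path e)

  opaque
    finish-exists : ∃ Finish
    finish-exists with path e Fin.<? c
    ... | yes pe<c = path e , at-path pe<c
    ... | no  pe≮c = c , at-c (ℕ.≮⇒≥ pe≮c)

  finish : Pos
  finish = proj₁ finish-exists

  finish-case : Finish finish
  finish-case = proj₂ finish-exists

  Finish-≥l : ∀ {x} → Finish x → l Fin.≤ x
  Finish-≥l (at-c _)    = l≤c
  Finish-≥l (at-path _) = l≤path-e

  path∼Finish : ∀ {x} → Finish x → ∀ {i} → suc i ≡ e → path i ∼ x
  path∼Finish (at-c c≤pe) {i} i+1≡e = ∼-shrinkʳ (ℕ.<-≤-trans (path-<l i<e) l≤c)
    (subst (λ k → c Fin.≤ path k) (sym i+1≡e) c≤pe) (path-∼ i<e)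
    where
    i<e : i ℕ.< e
    i<e = ℕ.≤-reflexive i+1≡e
  path∼Finish (at-path _) {i} i+1≡e = subst (λ k → path i ∼ path k) i+1≡e (path-∼ (ℕ.≤-reflexive i+1≡e))

  -- The vertices contracted into the extra vertex of the cycle.
  Contracted : Fin n → Set
  Contracted w = Outside w ⊎ (w ≡ b a × reach a Fin.≤ l') ⊎ (w ≡ b c × path e Fin.< c)

  Start-attach : ∀ {x} → Start x → x ≡ a ⊎ (Contracted (b a) × Intersect (I (b x)) (I (b a)))
  Start-attach (from-a _)            = inj₁ refl
  Start-attach (from-l' ra≤l' a<l') = inj₂ (inj₂ (inj₁ (refl , ra≤l')) , ~⇒meet (~-sym G (B₁-clique a<l')))

  Finish-attach : ∀ {x} → Finish x → x ≡ c ⊎ (Contracted (b c) × Intersect (I (b x)) (I (b c)))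
  Finish-attach (at-c _)       = inj₁ refl
  Finish-attach (at-path pe<c) = inj₂ (inj₂ (inj₂ (refl , pe<c)) , ~⇒meet (B₂-clique l≤path-e pe<c))

  opaque
    attach-ends : ∃ λ (H : Hull Contracted) → Intersect (I (b start)) (span H) × Intersect (I (b finish)) (span H)
    attach-ends with attach (Hull-weaken inj₁ hull) a-meet (Sum.map₁ (cong b) (Start-attach start-case))
    ... | H₁ , hull⊆H₁ , start-meet with attach H₁ (Intersect-⊆ c-meet hull⊆H₁) (Sum.map₁ (cong b) (Finish-attach finish-case))
    ...   | H₂ , H₁⊆H₂ , finish-meet = H₂ , Intersect-⊆ start-meet H₁⊆H₂ , finish-meet

  Start-≢a : ∀ {x} → Start x → reach a Fin.≤ l' → a ≢ x
  Start-≢a (from-a l'<ra)  ra≤l' _     = ℕ.<-irrefl refl (ℕ.<-≤-trans l'<ra ra≤l')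
  Start-≢a (from-l' _ a<l') _    a≡l' = ℕ.<-irrefl (cong toℕ a≡l') a<l'

  Finish-≢c : ∀ {x} → Finish x → path e Fin.< c → c ≢ x
  Finish-≢c (at-c c≤pe) pe<c _     = ℕ.<-irrefl refl (ℕ.<-≤-trans pe<c c≤pe)
  Finish-≢c (at-path _) pe<c c≡pe = ℕ.<-irrefl (cong toℕ (sym c≡pe)) pe<c

  contracted : Hull Contracted
  contracted = proj₁ attach-ends

  pos : ℕ → Pos
  pos i with i ℕ.<? e
  ... | yes _ = path i
  ... | no  _ = finish

  pos-< : ∀ {i} → i ℕ.< e → pos i ≡ path i
  pos-< {i} i<e with i ℕ.<? e
  ... | yes _   = refl
  ... | no  i≮e = contradiction i<e i≮e

  pos-e : pos e ≡ finish
  pos-e with e ℕ.<? e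
  ... | yes e<e = contradiction e<e (ℕ.<-irrefl refl)
  ... | no  _   = refl

  0<e : 0 ℕ.< e
  0<e = ℕ.n≢0⇒n>0 λ e≡0 → ℕ.<-irrefl refl
    (ℕ.<-≤-trans (ℕ.≤-<-trans (Start-≤l' start-case) l'<l) (subst (λ k → l Fin.≤ path k) e≡0 l≤path-e))

  path-mono-≤ : ∀ {i j} → i ℕ.≤ j → j ℕ.≤ e → path i Fin.≤ path j
  path-mono-≤ i≤j j≤e with ℕ.m≤n⇒m<n∨m≡n i≤j
  ... | inj₁ i<j  = ℕ.<⇒≤ (path-mono i<j j≤e)
  ... | inj₂ refl = ℕ.≤-refl

  pos-mono : ∀ {i j} → i ℕ.< j → j ℕ.≤ e → pos i Fin.< pos j
  pos-mono {i} {j} i<j j≤e rewrite pos-< (ℕ.<-≤-trans i<j j≤e) with ℕ.m≤n⇒m<n∨m≡n j≤e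
  ... | inj₁ j<e  rewrite pos-< j<e = path-mono i<j (ℕ.<⇒≤ j<e)
  ... | inj₂ refl rewrite pos-e     = ℕ.<-≤-trans (path-<l i<j) (Finish-≥l finish-case)

  pos-injective : ∀ {i j} → i ℕ.≤ e → j ℕ.≤ e → pos i ≡ pos j → i ≡ j
  pos-injective {i} {j} i≤e j≤e eq with ℕ.<-cmp i j
  ... | tri< i<j _ _ = contradiction (cong toℕ eq) (ℕ.<⇒≢ (pos-mono i<j j≤e))
  ... | tri≈ _ i≡j _ = i≡j
  ... | tri> _ _ j<i = contradiction (cong toℕ eq) (ℕ.>⇒≢ (pos-mono j<i i≤e))

  l'<pos : ∀ {i} → 0 ℕ.< i → i ℕ.≤ e → l' Fin.< pos i
  l'<pos 0<i i≤e with ℕ.m≤n⇒m<n∨m≡n i≤e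
  ... | inj₁ i<e  rewrite pos-< i<e = l'<path 0<i i≤e
  ... | inj₂ refl rewrite pos-e     = ℕ.<-≤-trans l'<l (Finish-≥l finish-case)

  pos-∼ : ∀ {i} → i ℕ.< e → pos i ∼ pos (suc i)
  pos-∼ {i} i<e rewrite pos-< i<e with ℕ.m≤n⇒m<n∨m≡n i<e
  ... | inj₁ i+1<e  rewrite pos-< i+1<e = path-∼ i<e
  ... | inj₂ i+1≡e rewrite i+1≡e | pos-e = path∼Finish finish-case i+1≡e

  pos-induced : ∀ {i j} → suc i ℕ.< j → j ℕ.≤ e → ¬ pos i ∼ pos j
  pos-induced {i} {j} i+1<j j≤e rewrite pos-< (ℕ.<-trans (ℕ.n<1+n i) (ℕ.<-≤-trans i+1<j j≤e)) =
    IsMaxCN-≁ (reach-IsMaxCN (path i))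
      (subst (Fin._< pos j) (pos-< (ℕ.<-≤-trans i+1<j j≤e)) (pos-mono i+1<j j≤e))

  pos-isolated : ∀ {i w} → 0 ℕ.< i → i ℕ.< e → Contracted w → ¬ _~_ G (b (pos i)) w
  pos-isolated {i} 0<i i<e w∈C rewrite pos-< i<e with w∈C
  ... | inj₁ w∉B                   = inner-isolated (l'<path 0<i (ℕ.<⇒≤ i<e)) (path-<l i<e) w∉B
  ... | inj₂ (inj₁ (refl , ra≤l')) = λ p~a → IsMaxCN-≁ (reach-IsMaxCN a)
                                       (ℕ.≤-<-trans ra≤l' (l'<path 0<i (ℕ.<⇒≤ i<e))) (~-sym G p~a)
  ... | inj₂ (inj₂ (refl , pe<c))  = IsMaxCN-≁ (reach-IsMaxCN (path i)) (ℕ.≤-<-trans (path-mono-≤ i<e ℕ.≤-refl) pe<c)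

  pos∉Contracted : ∀ {i} → i ℕ.≤ e → ¬ Contracted (b (pos i))
  pos∉Contracted {i} _ (inj₁ out) = out (pos i , refl)
  pos∉Contracted {zero} _ (inj₂ (inj₁ (eq , ra≤l'))) =
    Start-≢a start-case ra≤l' (trans (sym (b-inj _ _ eq)) (pos-< 0<e))
  pos∉Contracted {suc i} i≤e (inj₂ (inj₁ (eq , _))) =
    ℕ.<-irrefl refl (ℕ.<-≤-trans (l'<pos (s≤s z≤n) i≤e) (subst (Fin._≤ l') (sym (b-inj _ _ eq)) a≤l'))
  pos∉Contracted {i} i≤e (inj₂ (inj₂ (eq , pe<c))) with ℕ.m≤n⇒m<n∨m≡n i≤e
  ... | inj₁ i<e = ℕ.<-irrefl refl (ℕ.<-≤-trans (path-<l i<e)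
                     (subst (l Fin.≤_) (trans (sym (b-inj _ _ eq)) (pos-< i<e)) l≤c))
  ... | inj₂ refl = Finish-≢c finish-case pe<c (trans (sym (b-inj _ _ eq)) pos-e)

  J : ℕ → Interval
  J zero    = span contracted
  J (suc i) = I (b (pos i))

  At : ℕ → Fin n → Set
  At zero    x = Contracted x
  At (suc i) x = x ≡ b (pos i)

  At-unique : ∀ {i j x} → i ℕ.≤ suc e → j ℕ.≤ suc e → At i x → At j x → i ≡ j
  At-unique {zero}  {zero}  _         _         _    _    = refl
  At-unique {zero}  {suc j} _         (s≤s j≤e) x∈C refl = contradiction x∈C (pos∉Contracted j≤e)
  At-unique {suc i} {zero}  (s≤s i≤e) _         refl x∈C = contradiction x∈C (pos∉Contracted i≤e)
  At-unique {suc i} {suc j} (s≤s i≤e) (s≤s j≤e) refl eq  = cong suc (pos-injective i≤e j≤e (b-inj _ _ eq))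

  cycle : TaggedCycle (suc e) J (PairTag At) F
  cycle = record
    { adjacent-meet = adjacent-meet
    ; chord-tagged  = chord-tagged
    ; tag-injective = PairTag-injective At-unique
    }
    where
    adjacent-meet : ∀ {i j} → Adjacent (suc e) i j → Intersect (J i) (J j)
    adjacent-meet {zero}  (inj₁ (refl , _)) =
      Intersect-sym (subst (λ x → Intersect (I (b x)) (span contracted)) (sym (pos-< 0<e)) (proj₁ (proj₂ attach-ends)))
    adjacent-meet {suc i} (inj₁ (refl , s≤s i<e)) = ~⇒meet (pos-∼ i<e)
    adjacent-meet         (inj₂ (refl , refl)) =
      Intersect-sym (subst (λ x → Intersect (I (b x)) (span contracted)) (sym pos-e) (proj₂ (proj₂ attach-ends)))

    chord-tagged : ∀ {i j} → Chord (suc e) i j → Intersect (J i) (J j) → ∃ λ t → t ∈ F × PairTag At i j t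
    chord-tagged {zero} {suc j} (_ , s≤s j≤e , ¬adj) meet with Hull-meet contracted meet
    ... | w , w∈C , x-w with meet⇒F (λ { refl → pos∉Contracted j≤e w∈C }) (pos-isolated 0<j j<e w∈C) x-w
      where
      0<j : 0 ℕ.< j
      0<j = ℕ.n≢0⇒n>0 λ { refl → ¬adj (inj₁ (refl , s≤s z≤n)) }
      j<e : j ℕ.< e
      j<e = ℕ.≤∧≢⇒< j≤e λ { refl → ¬adj (inj₂ (refl , refl)) }
    ...   | inj₁ xw∈F = _ , xw∈F , w , _ , w∈C , refl , inj₂ refl
    ...   | inj₂ wx∈F = _ , wx∈F , w , _ , w∈C , refl , inj₁ refl
    chord-tagged {suc i} {suc j} (s≤s i<j , s≤s j≤e , ¬adj) meet
      with meet⇒F (λ eq → ℕ.<-irrefl (pos-injective (ℕ.<⇒≤ (ℕ.<-≤-trans i<j j≤e)) j≤e (b-inj _ _ eq)) i<j)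
                  (pos-induced i+1<j j≤e) meet
      where
      i+1<j : suc i ℕ.< j
      i+1<j = ℕ.≤∧≢⇒< i<j λ { refl → ¬adj (inj₁ (refl , s≤s j≤e)) }
    ... | inj₁ xy∈F = _ , xy∈F , _ , _ , refl , refl , inj₁ refl
    ... | inj₂ yx∈F = _ , yx∈F , _ , _ , refl , refl , inj₂ refl

  jumps≤1+|F| : jumps ks ℕ.≤ suc (length F)
  jumps≤1+|F| = ℕ.≤-trans jumps≤e (ℕ.≤-pred (TaggedCycle⇒s≤2+|F| (suc e) cycle))

lemma7 : ∀ {n} (G : Graph n) (k : ℕ) → 1 ≤ k →
         ∀ {m} (b : Fin (suc m) → Fin n) (B : TwoBranch G b) (p : ℕ) →
         KJoinCount G b B p → k + 4 ≤ p → SameComponent G b B →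
         ¬ (∃ λ F → IsCompletion G k F)
lemma7 G k _ b B .(suc q) (q , refl , ks) k+4≤p SC (F , |F|≤k , _ , I , I-proper , I-model , _) =
  ℕ.<-irrefl refl (ℕ.≤-trans k+2≤jumps (ℕ.≤-trans jumps≤1+|F| (s≤s |F|≤k)))
  where
  open TwoBranchFacts G b B using (jumps; count≤1+jumps)
  k+2≤jumps : suc (suc k) ≤ jumps ks
  k+2≤jumps = ℕ.≤-pred (ℕ.≤-pred (ℕ.≤-trans (subst (_≤ suc q) (ℕ.+-comm k 4) k+4≤p) (s≤s (count≤1+jumps ks))))
  open Completion G b B SC ks (ℕ.≤-trans (s≤s (s≤s z≤n)) k+2≤jumps) F I I-proper I-model using (jumps≤1+|F|)
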